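{- If $\mathcal M=(W,\preccurlyeq,V)$ is a finite poset model, then the map $\max:N(W)\to W$, sending a finite nonempty chain to its maximal element, is an up-down morphism from the nerve model $N(\mathcal M)$ to $\mathcal M$.
   Context: A finite poset model is $(W,\preccurlyeq,V)$ with $W$ finite, $\preccurlyeq$ a partial order and $V:\mathbb P\to 2^W$. The nerve $N(W)$ is the set of finite nonempty chains of $(W,\preccurlyeq)$ ordered by inclusion $\subseteq$; the nerve model is $N(\mathcal M)=(N(W),\subseteq,V^N)$ with $V^N(p)=\{c\in N(W):\max(c)\in V(p)\}$. Write $x\prec y$ for $x\preccurlyeq y$ and $y\not\preccurlyeq x$. An up-down path is a sequence $(w_0,\dots,w_k)$ with $k=2j$, $j>0$, $w_0\preccurlyeq w_1$, $w_{k-1}\succcurlyeq w_k$, and $w_{2i-1}\succ w_{2i}\prec w_{2i+1}$ whenever $0<i<j$. For finite poset models $(W,\preccurlyeq,V)$, $(W',\preccurlyeq',V')$, a map $f:W\to W'$ is an up-down morphism if: (atom) $w\in V(p)$ implies $f(w)\in V'(p)$; (forth) $w\preccurlyeq u\succcurlyeq v$ implies $f(w)\preccurlyeq' f(u)\succcurlyeq' f(v)$; (back) if $f(w)\preccurlyeq' u'\succcurlyeq' v'$ then there is an up-down path $(v_0,\dots,v_k)$ in $W$ with $v_0=w$, $f(v_k)=v'$ and $f(v_i)=u'$ for all $i\in(0,k)$. -}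

module Defs where

open import Data.Nat using (ℕ; zero; suc; _<_; _*_; _∸_; _+_)
open import Data.Fin using (Fin)
open import Data.List using (List; _∷_)
open import Data.List.Membership.Propositional using (_∈_)
open import Data.List.Relation.Unary.Linked using (Linked)
open import Data.Product using (Σ; _×_)
open import Relation.Nullary using (¬_)
open import Relation.Binary.PropositionalEquality using (_≡_)

module _ {X : Set} (_≤_ : X → X → Set) where

  Strict : X → X → Set
  Strict x y = (x ≤ y) × ¬ (y ≤ x)

  -- An up-down path (w_0,…,w_k), k = 2j, j > 0, given as a sequence
  -- v : ℕ → X of which only the entries v 0 … v k matter.
  UpDownPath : (j : ℕ) → (ℕ → X) → Set
  UpDownPath j v =
      (0 < j)
    × (v 0 ≤ v 1)
    × (v (2 * j) ≤ v (2 * j ∸ 1))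
    × (∀ i → 0 < i → i < j →
         Strict (v (2 * i)) (v (2 * i ∸ 1))
       × Strict (v (2 * i)) (v (2 * i + 1)))

module _ {P X Y : Set}
         (_≤X_ : X → X → Set) (VX : P → X → Set)
         (_≤Y_ : Y → Y → Set) (VY : P → Y → Set) where

  record IsUpDownMorphism (f : X → Y) : Set where
    field
      atom  : ∀ p w → VX p w → VY p (f w)
      forth : ∀ w u v → w ≤X u → v ≤X u → (f w ≤Y f u) × (f v ≤Y f u)
      back  : ∀ w u′ v′ → f w ≤Y u′ → v′ ≤Y u′ →
              Σ ℕ λ j → Σ (ℕ → X) λ vs →
                  UpDownPath _≤X_ j vs
                × vs 0 ≡ w
                × f (vs (2 * j)) ≡ v′
                × (∀ i → 0 < i → i < 2 * j → f (vs i) ≡ u′)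

-- The nerve of a finite poset on Fin n.
-- A finite nonempty chain is represented (uniquely) by the list of its
-- elements in strictly decreasing order: top ≻ x₁ ≻ … ≻ x_m.

module Nerve {n : ℕ} (_≼_ : Fin n → Fin n → Set) where

  _≻_ : Fin n → Fin n → Set
  x ≻ y = Strict _≼_ y x

  record Chain : Set where
    constructor chain
    field
      top    : Fin n
      rest   : List (Fin n)
      linked : Linked _≻_ (top ∷ rest)

  _∈ᶜ_ : Fin n → Chain → Set
  x ∈ᶜ c = x ∈ (Chain.top c ∷ Chain.rest c)

  _⊆ᶜ_ : Chain → Chain → Set
  c ⊆ᶜ d = ∀ x → x ∈ᶜ c → x ∈ᶜ d

  max : Chain → Fin n
  max = Chain.top

  Vᴺ : {P : Set} → (P → Fin n → Set) → P → Chain → Set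
  Vᴺ V p c = V p (max c)

{-# OPTIONS --safe #-}
module Submission where

-- Forth holds because every element of a chain lies below its maximum. For back, given
-- max c ≼ u′ ≽ v′, enlarge c to a chain e with maximum u′. If v′ = u′, the path is
-- c ⊆ e ⊇ e. Otherwise it is c ⊆ e ⊋ {u′} ⊊ {u′, v′} ⊇ {v′}, provided e has an element
-- besides u′; if it does not, e = {u′} and the shorter path c ⊆ {u′, v′} ⊇ {v′} works.

open import Defs
open import Data.Nat using (ℕ; suc; _*_; _<_; s≤s; z≤n)
open import Data.Fin using (Fin)
open import Data.Fin.Properties using (_≟_)
open import Data.List using ([]; _∷_)
open import Data.List.Relation.Unary.All using (lookup)
open import Data.List.Relation.Unary.Any using (here; there)
open import Data.List.Relation.Unary.Any.Properties using (singleton⁻)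
open import Data.List.Relation.Unary.Linked using ([-]; _∷_)
import Data.List.Relation.Unary.Linked as Linked
open import Data.List.Relation.Unary.Linked.Properties using (Linked⇒All)
open import Data.Product using (Σ; _×_; _,_; proj₁)
open import Function using (flip)
open import Relation.Nullary using (yes; no)
open import Relation.Binary.PropositionalEquality using (_≡_; _≢_; refl; sym; subst)
open import Relation.Binary.Structures using (IsPartialOrder)

module _ {X Y : Set} (_≤_ : X → X → Set) (f : X → Y) where

  UpDownLift : X → Y → Y → Set
  UpDownLift w u′ v′ =
    Σ ℕ λ j → Σ (ℕ → X) λ vs →
        UpDownPath _≤_ j vs
      × vs 0 ≡ w
      × f (vs (2 * j)) ≡ v′
      × (∀ i → 0 < i → i < 2 * j → f (vs i) ≡ u′)

  upDownLift₁ : ∀ a b c {u′ v′} → a ≤ b → c ≤ b → f b ≡ u′ → f c ≡ v′ → UpDownLift a u′ v′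
  upDownLift₁ a b c a≤b c≤b fb≡u′ fc≡v′ =
    1 , path ,
    (s≤s z≤n , a≤b , c≤b , λ { (suc _) _ (s≤s ()) }) ,
    refl , fc≡v′ ,
    λ { 1 _ _ → fb≡u′ ; (suc (suc _)) _ (s≤s (s≤s ())) }
    where
      path : ℕ → X
      path 0 = a
      path 1 = b
      path _ = c

  upDownLift₂ : ∀ a b c d e {u′ v′} →
                a ≤ b → Strict _≤_ c b → Strict _≤_ c d → e ≤ d →
                f b ≡ u′ → f c ≡ u′ → f d ≡ u′ → f e ≡ v′ → UpDownLift a u′ v′
  upDownLift₂ a b c d e a≤b c<b c<d e≤d fb≡u′ fc≡u′ fd≡u′ fe≡v′ =
    2 , path ,
    (s≤s z≤n , a≤b , e≤d , λ { 1 _ _ → c<b , c<d ; (suc (suc _)) _ (s≤s (s≤s ())) }) ,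
    refl , fe≡v′ ,
    λ { 1 _ _ → fb≡u′ ; 2 _ _ → fc≡u′ ; 3 _ _ → fd≡u′
      ; (suc (suc (suc (suc _)))) _ (s≤s (s≤s (s≤s (s≤s ())))) }
    where
      path : ℕ → X
      path 0 = a
      path 1 = b
      path 2 = c
      path 3 = d
      path _ = e

module NerveOfPoset {n : ℕ} {_≼_ : Fin n → Fin n → Set} (po : IsPartialOrder _≡_ _≼_) where
  open Nerve _≼_
  open IsPartialOrder po using (antisym; reflexive) renaming (refl to ≼-refl; trans to ≼-trans)

  ≼∧≢⇒≻ : ∀ {u v} → v ≼ u → v ≢ u → u ≻ v
  ≼∧≢⇒≻ v≼u v≢u = v≼u , λ u≼v → v≢u (antisym v≼u u≼v)

  ⊆ᶜ-refl : ∀ c → c ⊆ᶜ c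
  ⊆ᶜ-refl _ _ x∈c = x∈c

  ⊆ᶜ-trans : ∀ c d e → c ⊆ᶜ d → d ⊆ᶜ e → c ⊆ᶜ e
  ⊆ᶜ-trans _ _ _ c⊆d d⊆e x x∈c = d⊆e x (c⊆d x x∈c)

  ≼-max : ∀ {x} (c : Chain) → x ∈ᶜ c → x ≼ max c
  ≼-max (chain t _ l) =
    lookup (Linked⇒All (flip ≼-trans) ≼-refl (Linked.map proj₁ l))

  max-mono : ∀ c d → c ⊆ᶜ d → max c ≼ max d
  max-mono c d c⊆d = ≼-max d (c⊆d (max c) (here refl))

  singletonᶜ : Fin n → Chain
  singletonᶜ u = chain u [] [-]

  pairᶜ : ∀ {u v} → u ≻ v → Chain
  pairᶜ {u} {v} u≻v = chain u (v ∷ []) (u≻v ∷ [-])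

  singletonᶜ-⊆ : ∀ {u} e → u ∈ᶜ e → singletonᶜ u ⊆ᶜ e
  singletonᶜ-⊆ e u∈e x x∈[u] = subst (_∈ᶜ e) (sym (singleton⁻ x∈[u])) u∈e

  singletonᶜ-⊂ : ∀ {u z} e → u ∈ᶜ e → z ∈ᶜ e → u ≻ z → Strict _⊆ᶜ_ (singletonᶜ u) e
  singletonᶜ-⊂ e u∈e z∈e (_ , u⋠z) =
    singletonᶜ-⊆ e u∈e , λ e⊆[u] → u⋠z (reflexive (sym (singleton⁻ (e⊆[u] _ z∈e))))

  extend-max : ∀ c u → max c ≼ u → Σ Chain λ e → max e ≡ u × c ⊆ᶜ e
  extend-max c@(chain t rest l) u t≼u with t ≟ u
  ... | yes t≡u = c , t≡u , ⊆ᶜ-refl c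
  ... | no t≢u  = chain u (t ∷ rest) (≼∧≢⇒≻ t≼u t≢u ∷ l) , refl , λ _ → there

  back-≻ : ∀ {u} v c e → max e ≡ u → c ⊆ᶜ e → u ≻ v → UpDownLift _⊆ᶜ_ max c u v
  back-≻ v c (chain u [] _) refl c⊆[u] u≻v =
    upDownLift₁ _⊆ᶜ_ max c (pairᶜ u≻v) (singletonᶜ v)
      (⊆ᶜ-trans c (singletonᶜ u) (pairᶜ u≻v) c⊆[u] (singletonᶜ-⊆ (pairᶜ u≻v) (here refl)))
      (singletonᶜ-⊆ (pairᶜ u≻v) (there (here refl)))
      refl refl
  back-≻ v c e@(chain u (z ∷ _) (u≻z ∷ _)) refl c⊆e u≻v =
    upDownLift₂ _⊆ᶜ_ max c e (singletonᶜ u) (pairᶜ u≻v) (singletonᶜ v) c⊆e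
      (singletonᶜ-⊂ e (here refl) (there (here refl)) u≻z)
      (singletonᶜ-⊂ (pairᶜ u≻v) (here refl) (there (here refl)) u≻v)
      (singletonᶜ-⊆ (pairᶜ u≻v) (there (here refl)))
      refl refl refl refl

  back : ∀ c u v → max c ≼ u → v ≼ u → UpDownLift _⊆ᶜ_ max c u v
  back c u v c≼u v≼u with extend-max c u c≼u | v ≟ u
  ... | e , e↑u , c⊆e | yes refl = upDownLift₁ _⊆ᶜ_ max c e e c⊆e (⊆ᶜ-refl e) e↑u e↑u
  ... | e , e↑u , c⊆e | no v≢u   = back-≻ v c e e↑u c⊆e (≼∧≢⇒≻ v≼u v≢u)

  max-isUpDownMorphism : ∀ {P : Set} (V : P → Fin n → Set) →
                         IsUpDownMorphism _⊆ᶜ_ (Vᴺ V) _≼_ V max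
  max-isUpDownMorphism V = record
    { atom  = λ _ _ Vmax → Vmax
    ; forth = λ w u v w⊆u v⊆u → max-mono w u w⊆u , max-mono v u v⊆u
    ; back  = back
    }

mainTheorem9 : (P : Set) (n : ℕ) (_≼_ : Fin n → Fin n → Set)
    → IsPartialOrder _≡_ _≼_
    → (V : P → Fin n → Set)
    → IsUpDownMorphism (Nerve._⊆ᶜ_ _≼_) (Nerve.Vᴺ _≼_ V) _≼_ V (Nerve.max _≼_)
mainTheorem9 P n _≼_ po V = NerveOfPoset.max-isUpDownMorphism po V
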